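{- The Chang group $G_L$ of any totally ordered Gödel algebra $L$ is isomorphic, as an ordered group, to the totally ordered group $\mathbb{Z}$.
   Context: A BL-algebra is an algebra $(L,\wedge,\vee,\otimes,\to,0,1)$ such that $(L,\wedge,\vee,0,1)$ is a bounded lattice, $(L,\otimes,1)$ is a commutative monoid, $x\otimes y\le z$ iff $x\le y\to z$, $x\wedge y=x\otimes(x\to y)$, and $(x\to y)\vee(y\to x)=1$. A Gödel algebra is a BL-algebra satisfying $x\otimes x=x$. Put $\bar x=x\to0$, $x\oslash y=\bar x\to y$, $x+y=(x\oslash y)\wedge(y\oslash x)$. A good sequence is a sequence $(a_1,a_2,\ldots)$ in $L$ with $a_i+a_{i+1}=a_i$ for all $i$ and $a_r=0$ for large $r$. Sum: $(\mathbf{a}+\mathbf{b})_i=a_i+(a_{i-1}\otimes b_1)+\cdots+(a_1\otimes b_{i-1})+b_i$. $M_L$ is the commutative monoid of good sequences, ordered componentwise. The Chang group $G_L=(M_L\times M_L)/\sim$, $(\mathbf{a},\mathbf{b})\sim(\mathbf{c},\mathbf{d})$ iff $\mathbf{a}+\mathbf{d}+\mathbf{k}=\mathbf{b}+\mathbf{c}+\mathbf{k}$ for some $\mathbf{k}\in M_L$; classes $[\mathbf{a},\mathbf{b}]$, $[\mathbf{a},\mathbf{b}]+[\mathbf{c},\mathbf{d}]=[\mathbf{a}+\mathbf{c},\mathbf{b}+\mathbf{d}]$, order $[\mathbf{a},\mathbf{b}]\preceq[\mathbf{c},\mathbf{d}]$ iff $\mathbf{a}+\mathbf{d}+\mathbf{k}\le\mathbf{b}+\mathbf{c}+\mathbf{k}$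 for some $\mathbf{k}\in M_L$. -}

module Defs where

open import Data.Nat using (ℕ; zero; suc; _∸_) renaming (_≤_ to _≤ℕ_)
open import Data.Integer using (ℤ) renaming (_+_ to _+ℤ_; _≤_ to _≤ℤ_)
open import Data.Product using (Σ; ∃; _×_; _,_; proj₁; proj₂)
open import Data.Sum using (_⊎_)
open import Relation.Binary.PropositionalEquality using (_≡_; _≢_)

LatLE : {A : Set} → (A → A → A) → A → A → Set
LatLE _∧_ x y = (x ∧ y) ≡ x

record IsGodelAlgebra {A : Set} (_∧_ _∨_ _⊗_ _⇒_ : A → A → A) (𝟘 𝟙 : A) : Set where
  field
    ∧-comm     : ∀ x y → (x ∧ y) ≡ (y ∧ x)
    ∧-assoc    : ∀ x y z → ((x ∧ y) ∧ z) ≡ (x ∧ (y ∧ z))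
    ∨-comm     : ∀ x y → (x ∨ y) ≡ (y ∨ x)
    ∨-assoc    : ∀ x y z → ((x ∨ y) ∨ z) ≡ (x ∨ (y ∨ z))
    ∧-absorb-∨ : ∀ x y → (x ∧ (x ∨ y)) ≡ x
    ∨-absorb-∧ : ∀ x y → (x ∨ (x ∧ y)) ≡ x
    𝟘-least    : ∀ x → (𝟘 ∧ x) ≡ 𝟘
    𝟙-greatest : ∀ x → (x ∧ 𝟙) ≡ x
    ⊗-comm     : ∀ x y → (x ⊗ y) ≡ (y ⊗ x)
    ⊗-assoc    : ∀ x y z → ((x ⊗ y) ⊗ z) ≡ (x ⊗ (y ⊗ z))
    ⊗-identity : ∀ x → (x ⊗ 𝟙) ≡ x
    residuation₁ : ∀ x y z → LatLE _∧_ (x ⊗ y) z → LatLE _∧_ x (y ⇒ z)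
    residuation₂ : ∀ x y z → LatLE _∧_ x (y ⇒ z) → LatLE _∧_ (x ⊗ y) z
    divisibility : ∀ x y → (x ∧ y) ≡ (x ⊗ (x ⇒ y))
    prelinearity : ∀ x y → ((x ⇒ y) ∨ (y ⇒ x)) ≡ 𝟙
    ⊗-idem : ∀ x → (x ⊗ x) ≡ x

record GodelAlgebra : Set₁ where
  field
    Carrier : Set
    _∧_ _∨_ _⊗_ _⇒_ : Carrier → Carrier → Carrier
    𝟘 𝟙 : Carrier
    isGodelAlgebra : IsGodelAlgebra _∧_ _∨_ _⊗_ _⇒_ 𝟘 𝟙

  _≤_ : Carrier → Carrier → Set
  _≤_ = LatLE _∧_

  ¬_ : Carrier → Carrier
  ¬ x = x ⇒ 𝟘

  _⊘_ : Carrier → Carrier → Carrier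
  x ⊘ y = (¬ x) ⇒ y

  _⊕_ : Carrier → Carrier → Carrier
  x ⊕ y = (x ⊘ y) ∧ (y ⊘ x)

  -- Sequences a = (a₁, a₂, …) are represented 0-indexed: a i stands for a_{i+1}.
  Seq : Set
  Seq = ℕ → Carrier

  -- 1-indexed view, with the convention a_0 = 1 (so a_0 ⊗ b_i = b_i, a_i ⊗ b_0 = a_i)
  ext : Seq → ℕ → Carrier
  ext a zero    = 𝟙
  ext a (suc k) = a k

  sumTo : (ℕ → Carrier) → ℕ → Carrier
  sumTo t zero    = t zero
  sumTo t (suc n) = sumTo t n ⊕ t (suc n)

  -- (a + b)_i = a_i + (a_{i-1} ⊗ b_1) + ⋯ + (a_1 ⊗ b_{i-1}) + b_i
  _+ˢ_ : Seq → Seq → Seq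
  (a +ˢ b) k = sumTo (λ j → ext a (suc k ∸ j) ⊗ ext b j) (suc k)

  _≗ˢ_ : Seq → Seq → Set
  a ≗ˢ b = ∀ i → a i ≡ b i

  _≤ˢ_ : Seq → Seq → Set
  a ≤ˢ b = ∀ i → a i ≤ b i

  record GoodSeq : Set where
    field
      seq  : Seq
      good : ∀ i → (seq i ⊕ seq (suc i)) ≡ seq i
      fin  : ∃ λ r → ∀ i → r ≤ℕ i → seq i ≡ 𝟘
  open GoodSeq public

  -- pairs (a , b) of good sequences, representing [a , b] in the Chang group
  Pair : Set
  Pair = GoodSeq × GoodSeq

  _∼_ : Pair → Pair → Set
  (a , b) ∼ (c , d) =
    Σ GoodSeq λ k → ((seq a +ˢ seq d) +ˢ seq k) ≗ˢ ((seq b +ˢ seq c) +ˢ seq k)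

  _⪯_ : Pair → Pair → Set
  (a , b) ⪯ (c , d) =
    Σ GoodSeq λ k → ((seq a +ˢ seq d) +ˢ seq k) ≤ˢ ((seq b +ˢ seq c) +ˢ seq k)

  IsPairSum : Pair → Pair → Pair → Set
  IsPairSum (a , b) (c , d) (e , g) =
    (seq e ≗ˢ (seq a +ˢ seq c)) × (seq g ≗ˢ (seq b +ˢ seq d))

  TotallyOrdered : Set
  TotallyOrdered = ∀ x y → (x ≤ y) ⊎ (y ≤ x)

  -- An isomorphism of ordered groups  G_L ≅ ℤ, given on representatives:
  -- f : M_L × M_L → ℤ which is well defined and injective on ∼-classes, surjective,
  -- additive, and an order embedding.
  record ChangIsoℤ : Set where
    field
      closed     : ∀ (a b : GoodSeq) → Σ GoodSeq λ e → seq e ≗ˢ (seq a +ˢ seq b)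
      f          : Pair → ℤ
      respects   : ∀ p q → p ∼ q → f p ≡ f q
      reflects   : ∀ p q → f p ≡ f q → p ∼ q
      surjective : ∀ (n : ℤ) → Σ Pair λ p → f p ≡ n
      additive   : ∀ p q r → IsPairSum p q r → f r ≡ (f p +ℤ f q)
      monotone   : ∀ p q → p ⪯ q → f p ≤ℤ f q
      reflectsOrd : ∀ p q → f p ≤ℤ f q → p ⪯ q

module Submission where

-- In such an L, ⊗ is the minimum and ¬x = 𝟘 for every x ≠ 𝟘, so the
-- truncated sum ⊕ has 𝟘 as neutral element and sends two nonzero arguments to 𝟙.
-- Consequently every good sequence has the "shape" (𝟙, …, 𝟙, κ, 𝟘, 𝟘, …) with
-- κ ≠ 𝟘, and is determined by its length n (the position of κ) and its top
-- entry κ.  Adding good sequences adds lengths and multiplies top entries.  The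
-- map [a , b] ↦ len a - len b is then an isomorphism G_L ≅ ℤ: lengths decide
-- equality and order of shaped sequences up to the top entry, and the top
-- entries are equalised by adding the one-entry sequence (x ⊗ y, 𝟘, …), using
-- idempotence of ⊗.

open import Defs
open import Data.Nat as ℕ using (ℕ; zero; suc; _+_; _∸_; z≤n; s≤s; _≤′_; ≤′-refl; ≤′-step)
  renaming (_≤_ to _≤ℕ_; _<_ to _<ℕ_)
import Data.Nat.Properties as ℕP
open import Data.Integer as ℤ using (ℤ; +_; -[1+_]; +≤+)
  renaming (_+_ to _+ℤ_; _-_ to _-ℤ_; _≤_ to _≤ℤ_)
import Data.Integer.Properties as ℤP
open import Data.Integer.Tactic.RingSolver using (solve-∀)
open import Data.Product using (Σ; _,_; proj₁; proj₂)
open import Data.Sum using (_⊎_; inj₁; inj₂)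
open import Data.Empty using (⊥-elim)
open import Relation.Binary.Definitions using (tri<; tri≈; tri>)
open import Relation.Binary.PropositionalEquality

private
  add-back : ∀ x y v → x +ℤ v ≡ (x -ℤ y) +ℤ (y +ℤ v)
  add-back = solve-∀

  cross : ∀ u v y → (u -ℤ v) +ℤ (y +ℤ v) ≡ y +ℤ u
  cross = solve-∀

  subtract-both : ∀ x y v → x -ℤ y ≡ (x +ℤ v) -ℤ (y +ℤ v)
  subtract-both = solve-∀

  cancel-left : ∀ y u v → (y +ℤ u) -ℤ (y +ℤ v) ≡ u -ℤ v
  cancel-left = solve-∀

  regroup : ∀ x y u v → (x +ℤ u) -ℤ (y +ℤ v) ≡ (x -ℤ y) +ℤ (u -ℤ v)
  regroup = solve-∀

-≡⇒+≡ : ∀ x y u v → x -ℤ y ≡ u -ℤ v → x +ℤ v ≡ y +ℤ u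
-≡⇒+≡ x y u v e = begin
  x +ℤ v                ≡⟨ add-back x y v ⟩
  (x -ℤ y) +ℤ (y +ℤ v)  ≡⟨ cong (_+ℤ (y +ℤ v)) e ⟩
  (u -ℤ v) +ℤ (y +ℤ v)  ≡⟨ cross u v y ⟩
  y +ℤ u                ∎
  where open ≡-Reasoning

+≡⇒-≡ : ∀ x y u v → x +ℤ v ≡ y +ℤ u → x -ℤ y ≡ u -ℤ v
+≡⇒-≡ x y u v e = begin
  x -ℤ y                   ≡⟨ subtract-both x y v ⟩
  (x +ℤ v) -ℤ (y +ℤ v)     ≡⟨ cong (_-ℤ (y +ℤ v)) e ⟩
  (y +ℤ u) -ℤ (y +ℤ v)     ≡⟨ cancel-left y u v ⟩
  u -ℤ v                   ∎
  where open ≡-Reasoning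

-≤⇒+≤ : ∀ x y u v → x -ℤ y ≤ℤ u -ℤ v → x +ℤ v ≤ℤ y +ℤ u
-≤⇒+≤ x y u v h =
  subst₂ _≤ℤ_ (sym (add-back x y v)) (cross u v y) (ℤP.+-monoˡ-≤ (y +ℤ v) h)

+≤⇒-≤ : ∀ x y u v → x +ℤ v ≤ℤ y +ℤ u → x -ℤ y ≤ℤ u -ℤ v
+≤⇒-≤ x y u v h =
  subst₂ _≤ℤ_ (sym (subtract-both x y v)) (cancel-left y u v) (ℤP.+-monoˡ-≤ (ℤ.- (y +ℤ v)) h)

module GodelFacts (L : GodelAlgebra) where
  open GodelAlgebra L
  open IsGodelAlgebra isGodelAlgebra
  open ≡-Reasoning

  ∧-idem : ∀ x → (x ∧ x) ≡ x
  ∧-idem x = trans (cong (x ∧_) (sym (∨-absorb-∧ x x))) (∧-absorb-∨ x (x ∧ x))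

  ∧-zeroʳ : ∀ x → (x ∧ 𝟘) ≡ 𝟘
  ∧-zeroʳ x = trans (∧-comm x 𝟘) (𝟘-least x)

  ≤𝟘⇒≡𝟘 : ∀ {x} → x ≤ 𝟘 → x ≡ 𝟘
  ≤𝟘⇒≡𝟘 {x} h = trans (sym h) (∧-zeroʳ x)

  𝟙≤⇒≡𝟙 : ∀ {x} → 𝟙 ≤ x → x ≡ 𝟙
  𝟙≤⇒≡𝟙 {x} h = trans (sym (𝟙-greatest x)) (trans (∧-comm x 𝟙) h)

  ⊗-identityˡ : ∀ x → (𝟙 ⊗ x) ≡ x
  ⊗-identityˡ x = trans (⊗-comm 𝟙 x) (⊗-identity x)

  -- By residuation, x ≤ y gives 𝟙 ≤ x ⇒ y.
  ≤⇒⇒≡𝟙 : ∀ {x y} → x ≤ y → (x ⇒ y) ≡ 𝟙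
  ≤⇒⇒≡𝟙 {x} {y} h =
    𝟙≤⇒≡𝟙 (residuation₁ 𝟙 x y (subst (λ z → (z ∧ y) ≡ z) (sym (⊗-identityˡ x)) h))

  -- In a Gödel algebra ⊗ is the meet: x ≤ y gives x ⊗ y = x.
  -- (x = y ⊗ w with w = y ⇒ x by divisibility, and y ⊗ y = y.)
  ≤⇒⊗≡ : ∀ {x y} → x ≤ y → (x ⊗ y) ≡ x
  ≤⇒⊗≡ {x} {y} h = begin
      x ⊗ y        ≡⟨ cong (_⊗ y) x≡y⊗w ⟩
      (y ⊗ w) ⊗ y  ≡⟨ cong (_⊗ y) (⊗-comm y w) ⟩
      (w ⊗ y) ⊗ y  ≡⟨ ⊗-assoc w y y ⟩
      w ⊗ (y ⊗ y)  ≡⟨ cong (w ⊗_) (⊗-idem y) ⟩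
      w ⊗ y        ≡⟨ ⊗-comm w y ⟩
      y ⊗ w        ≡⟨ sym x≡y⊗w ⟩
      x            ∎
    where
      w = y ⇒ x
      x≡y⊗w : x ≡ (y ⊗ w)
      x≡y⊗w = trans (sym h) (trans (∧-comm x y) (divisibility y x))

  ⊗-zeroˡ : ∀ y → (𝟘 ⊗ y) ≡ 𝟘
  ⊗-zeroˡ y = ≤⇒⊗≡ (𝟘-least y)

  ⊗-zeroʳ : ∀ y → (y ⊗ 𝟘) ≡ 𝟘
  ⊗-zeroʳ y = trans (⊗-comm y 𝟘) (⊗-zeroˡ y)

  ⇒-identityˡ : ∀ y → (𝟙 ⇒ y) ≡ y
  ⇒-identityˡ y = begin
    𝟙 ⇒ y          ≡⟨ sym (⊗-identityˡ (𝟙 ⇒ y)) ⟩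
    𝟙 ⊗ (𝟙 ⇒ y)    ≡⟨ sym (divisibility 𝟙 y) ⟩
    𝟙 ∧ y          ≡⟨ ∧-comm 𝟙 y ⟩
    y ∧ 𝟙          ≡⟨ 𝟙-greatest y ⟩
    y              ∎

  𝟘⇒≡𝟙 : ∀ y → (𝟘 ⇒ y) ≡ 𝟙
  𝟘⇒≡𝟙 y = ≤⇒⇒≡𝟙 (𝟘-least y)

  -- x ≤ ¬x gives x = x ⊗ x ≤ 𝟘.
  ≤¬⇒≡𝟘 : ∀ {x} → x ≤ (¬ x) → x ≡ 𝟘
  ≤¬⇒≡𝟘 {x} h = ≤𝟘⇒≡𝟘 (subst (_≤ 𝟘) (⊗-idem x) (residuation₂ x x 𝟘 h))

  ¬≤⇒¬≡𝟘 : ∀ {x} → (¬ x) ≤ x → (¬ x) ≡ 𝟘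
  ¬≤⇒¬≡𝟘 {x} h = begin
    ¬ x          ≡⟨ sym (≤⇒⊗≡ h) ⟩
    (¬ x) ⊗ x    ≡⟨ ⊗-comm (¬ x) x ⟩
    x ⊗ (¬ x)    ≡⟨ sym (divisibility x 𝟘) ⟩
    x ∧ 𝟘        ≡⟨ ∧-zeroʳ x ⟩
    𝟘            ∎

  ⊗-absorb : ∀ x y → (x ⊗ (x ⊗ y)) ≡ (x ⊗ y)
  ⊗-absorb x y = trans (sym (⊗-assoc x x y)) (cong (_⊗ y) (⊗-idem x))

module TotalGodel (L : GodelAlgebra) (total : GodelAlgebra.TotallyOrdered L)
                  (𝟘≢𝟙 : GodelAlgebra.𝟘 L ≢ GodelAlgebra.𝟙 L) where
  open GodelAlgebra L
  open IsGodelAlgebra isGodelAlgebra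
  open GodelFacts L
  open ≡-Reasoning

  𝟙≢𝟘 : 𝟙 ≢ 𝟘
  𝟙≢𝟘 e = 𝟘≢𝟙 (sym e)

  𝟘-or-¬𝟘 : ∀ x → (x ≡ 𝟘) ⊎ ((¬ x) ≡ 𝟘)
  𝟘-or-¬𝟘 x with total x (¬ x)
  ... | inj₁ x≤¬x = inj₁ (≤¬⇒≡𝟘 x≤¬x)
  ... | inj₂ ¬x≤x = inj₂ (¬≤⇒¬≡𝟘 ¬x≤x)

  𝟘? : ∀ x → (x ≡ 𝟘) ⊎ (x ≢ 𝟘)
  𝟘? x with 𝟘-or-¬𝟘 x
  ... | inj₁ x≡𝟘 = inj₁ x≡𝟘
  ... | inj₂ ¬x≡𝟘 = inj₂ λ x≡𝟘 → 𝟙≢𝟘 (begin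
    𝟙      ≡⟨ sym (𝟘⇒≡𝟙 𝟘) ⟩
    ¬ 𝟘    ≡⟨ cong ¬_ (sym x≡𝟘) ⟩
    ¬ x    ≡⟨ ¬x≡𝟘 ⟩
    𝟘      ∎)

  ¬-nonzero : ∀ {x} → x ≢ 𝟘 → (¬ x) ≡ 𝟘
  ¬-nonzero {x} x≢𝟘 with 𝟘-or-¬𝟘 x
  ... | inj₁ x≡𝟘 = ⊥-elim (x≢𝟘 x≡𝟘)
  ... | inj₂ ¬x≡𝟘 = ¬x≡𝟘

  -- ⊗ is the minimum, so a product of nonzero elements is nonzero.
  ⊗-nonzero : ∀ {x y} → x ≢ 𝟘 → y ≢ 𝟘 → (x ⊗ y) ≢ 𝟘
  ⊗-nonzero {x} {y} x≢𝟘 y≢𝟘 with total x y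
  ... | inj₁ x≤y = λ e → x≢𝟘 (trans (sym (≤⇒⊗≡ x≤y)) e)
  ... | inj₂ y≤x = λ e → y≢𝟘 (trans (sym (≤⇒⊗≡ y≤x)) (trans (⊗-comm y x) e))

  ⊘-𝟘ˡ : ∀ y → (𝟘 ⊘ y) ≡ y
  ⊘-𝟘ˡ y = trans (cong (_⇒ y) (𝟘⇒≡𝟙 𝟘)) (⇒-identityˡ y)

  ⊘-nonzeroˡ : ∀ {x} y → x ≢ 𝟘 → (x ⊘ y) ≡ 𝟙
  ⊘-nonzeroˡ y x≢𝟘 = trans (cong (_⇒ y) (¬-nonzero x≢𝟘)) (𝟘⇒≡𝟙 y)

  ⊕-comm : ∀ x y → (x ⊕ y) ≡ (y ⊕ x)
  ⊕-comm x y = ∧-comm (x ⊘ y) (y ⊘ x)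

  ⊕-identityˡ : ∀ y → (𝟘 ⊕ y) ≡ y
  ⊕-identityˡ y with 𝟘? y
  ... | inj₁ refl = trans (cong (_∧ (𝟘 ⊘ 𝟘)) (⊘-𝟘ˡ 𝟘)) (𝟘-least (𝟘 ⊘ 𝟘))
  ... | inj₂ y≢𝟘 = trans (cong₂ _∧_ (⊘-𝟘ˡ y) (⊘-nonzeroˡ 𝟘 y≢𝟘)) (𝟙-greatest y)

  ⊕-identityʳ : ∀ x → (x ⊕ 𝟘) ≡ x
  ⊕-identityʳ x = trans (⊕-comm x 𝟘) (⊕-identityˡ x)

  ⊕-saturate : ∀ {x y} → x ≢ 𝟘 → y ≢ 𝟘 → (x ⊕ y) ≡ 𝟙
  ⊕-saturate {x} {y} x≢𝟘 y≢𝟘 =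
    trans (cong₂ _∧_ (⊘-nonzeroˡ y x≢𝟘) (⊘-nonzeroˡ x y≢𝟘)) (𝟙-greatest 𝟙)

  ⊕-𝟙ˡ : ∀ y → (𝟙 ⊕ y) ≡ 𝟙
  ⊕-𝟙ˡ y with 𝟘? y
  ... | inj₁ refl = ⊕-identityʳ 𝟙
  ... | inj₂ y≢𝟘 = ⊕-saturate 𝟙≢𝟘 y≢𝟘

  ⊕-𝟙ʳ : ∀ x → (x ⊕ 𝟙) ≡ 𝟙
  ⊕-𝟙ʳ x = trans (⊕-comm x 𝟙) (⊕-𝟙ˡ x)

  ⊕-nonzeroˡ : ∀ {x} y → x ≢ 𝟘 → (x ⊕ y) ≢ 𝟘
  ⊕-nonzeroˡ {x} y x≢𝟘 with 𝟘? y
  ... | inj₁ refl = subst (_≢ 𝟘) (sym (⊕-identityʳ x)) x≢𝟘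
  ... | inj₂ y≢𝟘 = subst (_≢ 𝟘) (sym (⊕-saturate x≢𝟘 y≢𝟘)) 𝟙≢𝟘

  ⊕-nonzeroʳ : ∀ x {y} → y ≢ 𝟘 → (x ⊕ y) ≢ 𝟘
  ⊕-nonzeroʳ x {y} y≢𝟘 = subst (_≢ 𝟘) (⊕-comm y x) (⊕-nonzeroˡ x y≢𝟘)

  sumTo-𝟘 : ∀ (t : ℕ → Carrier) n → (∀ j → j ≤ℕ n → t j ≡ 𝟘) → sumTo t n ≡ 𝟘
  sumTo-𝟘 t zero all𝟘 = all𝟘 0 z≤n
  sumTo-𝟘 t (suc n) all𝟘 = begin
    sumTo t n ⊕ t (suc n)  ≡⟨ cong₂ _⊕_ (sumTo-𝟘 t n (λ j j≤n → all𝟘 j (ℕP.m≤n⇒m≤1+n j≤n)))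
                                        (all𝟘 (suc n) ℕP.≤-refl) ⟩
    𝟘 ⊕ 𝟘                  ≡⟨ ⊕-identityˡ 𝟘 ⟩
    𝟘                      ∎

  sumTo-single : ∀ (t : ℕ → Carrier) m n → m ≤ℕ n →
                 (∀ j → j ≤ℕ n → j ≢ m → t j ≡ 𝟘) → sumTo t n ≡ t m
  sumTo-single t .zero zero z≤n others = refl
  sumTo-single t m (suc n) m≤1+n others with ℕP.m≤n⇒m<n∨m≡n m≤1+n
  ... | inj₁ (s≤s m≤n) = begin
    sumTo t n ⊕ t (suc n)  ≡⟨ cong₂ _⊕_
         (sumTo-single t m n m≤n (λ j j≤n → others j (ℕP.m≤n⇒m≤1+n j≤n)))
         (others (suc n) ℕP.≤-refl (λ e → ℕP.<⇒≢ (s≤s m≤n) (sym e))) ⟩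
    t m ⊕ 𝟘                ≡⟨ ⊕-identityʳ (t m) ⟩
    t m                    ∎
  ... | inj₂ refl = begin
    sumTo t n ⊕ t (suc n)  ≡⟨ cong (_⊕ t (suc n))
         (sumTo-𝟘 t n (λ j j≤n → others j (ℕP.m≤n⇒m≤1+n j≤n) (ℕP.<⇒≢ (s≤s j≤n)))) ⟩
    𝟘 ⊕ t (suc n)          ≡⟨ ⊕-identityˡ (t (suc n)) ⟩
    t (suc n)              ∎

  sumTo-nonzero : ∀ (t : ℕ → Carrier) m n → m ≤ℕ n → t m ≢ 𝟘 → sumTo t n ≢ 𝟘
  sumTo-nonzero t .zero zero z≤n tm≢𝟘 = tm≢𝟘
  sumTo-nonzero t m (suc n) m≤1+n tm≢𝟘 with ℕP.m≤n⇒m<n∨m≡n m≤1+n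
  ... | inj₁ (s≤s m≤n) = ⊕-nonzeroˡ (t (suc n)) (sumTo-nonzero t m n m≤n tm≢𝟘)
  ... | inj₂ refl = ⊕-nonzeroʳ (sumTo t n) tm≢𝟘

  sumTo-𝟙 : ∀ (t : ℕ → Carrier) m n → m ≤ℕ n → t m ≡ 𝟙 → sumTo t n ≡ 𝟙
  sumTo-𝟙 t .zero zero z≤n tm≡𝟙 = tm≡𝟙
  sumTo-𝟙 t m (suc n) m≤1+n tm≡𝟙 with ℕP.m≤n⇒m<n∨m≡n m≤1+n
  ... | inj₁ (s≤s m≤n) = trans (cong (_⊕ t (suc n)) (sumTo-𝟙 t m n m≤n tm≡𝟙)) (⊕-𝟙ˡ (t (suc n)))
  ... | inj₂ refl = trans (cong (sumTo t n ⊕_) tm≡𝟙) (⊕-𝟙ʳ (sumTo t n))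

  sumTo-two : ∀ (t : ℕ → Carrier) i j n → i <ℕ j → j ≤ℕ n →
              t i ≢ 𝟘 → t j ≢ 𝟘 → sumTo t n ≡ 𝟙
  sumTo-two t i .zero zero () z≤n _ _
  sumTo-two t i j (suc n) i<j j≤1+n ti≢𝟘 tj≢𝟘 with ℕP.m≤n⇒m<n∨m≡n j≤1+n
  ... | inj₁ (s≤s j≤n) =
    trans (cong (_⊕ t (suc n)) (sumTo-two t i j n i<j j≤n ti≢𝟘 tj≢𝟘)) (⊕-𝟙ˡ (t (suc n)))
  ... | inj₂ refl = ⊕-saturate (sumTo-nonzero t i n (ℕP.≤-pred i<j) ti≢𝟘) tj≢𝟘

  -- A sequence s has shape n when its 1-indexed view is (𝟙, …, 𝟙, κ, 𝟘, 𝟘, …)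
  -- with κ ≠ 𝟘 at position n (position 0 is the convention ext s 0 = 𝟙).
  record Shape (s : Seq) (n : ℕ) : Set where
    field
      below-𝟙 : ∀ m → m <ℕ n → ext s m ≡ 𝟙
      above-𝟘 : ∀ m → n <ℕ m → ext s m ≡ 𝟘
      top≢𝟘   : ext s n ≢ 𝟘
  open Shape

  ext-cong : ∀ {s s'} → s ≗ˢ s' → ∀ m → ext s m ≡ ext s' m
  ext-cong s≗s' zero = refl
  ext-cong s≗s' (suc m) = s≗s' m

  ext-mono : ∀ {s s'} → s ≤ˢ s' → ∀ m → ext s m ≤ ext s' m
  ext-mono s≤s' zero = ∧-idem 𝟙
  ext-mono s≤s' (suc m) = s≤s' m

  shape-cong : ∀ {s s' n} → s ≗ˢ s' → Shape s n → Shape s' n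
  shape-cong {n = n} s≗s' sh = record
    { below-𝟙 = λ m m<n → trans (sym (ext-cong s≗s' m)) (below-𝟙 sh m m<n)
    ; above-𝟘 = λ m n<m → trans (sym (ext-cong s≗s' m)) (above-𝟘 sh m n<m)
    ; top≢𝟘   = λ e → top≢𝟘 sh (trans (ext-cong s≗s' n) e)
    }

  shape-nonzero : ∀ {s n} → Shape s n → ∀ m → m ≤ℕ n → ext s m ≢ 𝟘
  shape-nonzero sh m m≤n with ℕP.m≤n⇒m<n∨m≡n m≤n
  ... | inj₁ m<n = subst (_≢ 𝟘) (sym (below-𝟙 sh m m<n)) 𝟙≢𝟘
  ... | inj₂ refl = top≢𝟘 sh

  shape-unique : ∀ {s n n'} → Shape s n → Shape s n' → n ≡ n'
  shape-unique {n = n} {n'} sh sh' with ℕP.<-cmp n n'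
  ... | tri< n<n' _ _ = ⊥-elim (top≢𝟘 sh' (above-𝟘 sh n' n<n'))
  ... | tri≈ _ n≡n' _ = n≡n'
  ... | tri> _ _ n'<n = ⊥-elim (top≢𝟘 sh (above-𝟘 sh' n n'<n))

  shape-≤ : ∀ {s s' n n'} → Shape s n → Shape s' n' → s ≤ˢ s' → n ≤ℕ n'
  shape-≤ {s} {s'} {n} {n'} sh sh' s≤s' with ℕP.≤-<-connex n n'
  ... | inj₁ n≤n' = n≤n'
  ... | inj₂ n'<n = ⊥-elim (top≢𝟘 sh
        (≤𝟘⇒≡𝟘 (subst (ext s n ≤_) (above-𝟘 sh' n n'<n) (ext-mono s≤s' n))))

  shape-≗ : ∀ {s s' n n'} → Shape s n → Shape s' n' → n ≡ n' →
            ext s n ≡ ext s' n' → s ≗ˢ s'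
  shape-≗ {n = n} sh sh' refl tops i with ℕP.<-cmp (suc i) n
  ... | tri< i<n _ _ = trans (below-𝟙 sh (suc i) i<n) (sym (below-𝟙 sh' (suc i) i<n))
  ... | tri≈ _ refl _ = tops
  ... | tri> _ _ n<i = trans (above-𝟘 sh (suc i) n<i) (sym (above-𝟘 sh' (suc i) n<i))

  shape-< : ∀ {s s' n n'} → Shape s n → Shape s' n' → n <ℕ n' → s ≤ˢ s'
  shape-< {s} {s'} {n} sh sh' n<n' i with ℕP.<-cmp (suc i) n
  ... | tri< i<n _ _ = begin
    s i ∧ s' i  ≡⟨ cong₂ _∧_ (below-𝟙 sh (suc i) i<n) (below-𝟙 sh' (suc i) (ℕP.<-trans i<n n<n')) ⟩
    𝟙 ∧ 𝟙       ≡⟨ ∧-idem 𝟙 ⟩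
    𝟙           ≡⟨ sym (below-𝟙 sh (suc i) i<n) ⟩
    s i         ∎
  ... | tri≈ _ refl _ = trans (cong (s i ∧_) (below-𝟙 sh' (suc i) n<n')) (𝟙-greatest (s i))
  ... | tri> _ _ n<i = begin
    s i ∧ s' i  ≡⟨ cong (_∧ s' i) (above-𝟘 sh (suc i) n<i) ⟩
    𝟘 ∧ s' i    ≡⟨ 𝟘-least (s' i) ⟩
    𝟘           ≡⟨ sym (above-𝟘 sh (suc i) n<i) ⟩
    s i         ∎

  shape-≤ˢ : ∀ {s s' n n'} → Shape s n → Shape s' n' → n ≤ℕ n' →
             ext s n ≡ ext s' n' → s ≤ˢ s'
  shape-≤ˢ {s} sh sh' n≤n' tops with ℕP.m≤n⇒m<n∨m≡n n≤n'
  ... | inj₁ n<n' = shape-< sh sh' n<n'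
  ... | inj₂ n≡n' = λ i → trans (cong (s i ∧_) (sym (shape-≗ sh sh' n≡n' tops i))) (∧-idem (s i))

  shape-good : ∀ {s n} → Shape s n → ∀ i → (s i ⊕ s (suc i)) ≡ s i
  shape-good {s} {n} sh i with ℕP.≤-<-connex n (suc i)
  ... | inj₁ n≤1+i =
    trans (cong (s i ⊕_) (above-𝟘 sh (suc (suc i)) (s≤s n≤1+i))) (⊕-identityʳ (s i))
  ... | inj₂ 1+i<n = begin
    s i ⊕ s (suc i)  ≡⟨ cong (_⊕ s (suc i)) (below-𝟙 sh (suc i) 1+i<n) ⟩
    𝟙 ⊕ s (suc i)    ≡⟨ ⊕-𝟙ˡ (s (suc i)) ⟩
    𝟙                ≡⟨ sym (below-𝟙 sh (suc i) 1+i<n) ⟩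
    s i              ∎

  toGood : ∀ {s n} → Shape s n → GoodSeq
  toGood {s} {n} sh = record
    { seq = s ; good = shape-good sh ; fin = n , λ i n≤i → above-𝟘 sh (suc i) (s≤s n≤i) }

  module _ (a : GoodSeq) where
    -- Zeros propagate to the right, since 𝟘 ⊕ y = y.
    good-𝟘-step : ∀ {i} → seq a i ≡ 𝟘 → seq a (suc i) ≡ 𝟘
    good-𝟘-step {i} ai≡𝟘 = begin
      seq a (suc i)            ≡⟨ sym (⊕-identityˡ (seq a (suc i))) ⟩
      𝟘 ⊕ seq a (suc i)        ≡⟨ cong (_⊕ seq a (suc i)) (sym ai≡𝟘) ⟩
      seq a i ⊕ seq a (suc i)  ≡⟨ good a i ⟩
      seq a i                  ≡⟨ ai≡𝟘 ⟩
      𝟘                        ∎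

    good-𝟘-up : ∀ {i j} → seq a i ≡ 𝟘 → i ≤′ j → seq a j ≡ 𝟘
    good-𝟘-up ai≡𝟘 ≤′-refl = ai≡𝟘
    good-𝟘-up ai≡𝟘 (≤′-step i≤′j) = good-𝟘-step (good-𝟘-up ai≡𝟘 i≤′j)

    -- An entry followed by a nonzero entry is 𝟙, since both are nonzero.
    good-𝟙-before : ∀ {i} → seq a (suc i) ≢ 𝟘 → seq a i ≡ 𝟙
    good-𝟙-before {i} nz = trans (sym (good a i)) (⊕-saturate (λ e → nz (good-𝟘-step e)) nz)

    shape-below : ∀ r → (∀ i → r ≤ℕ i → seq a i ≡ 𝟘) → Σ ℕ (Shape (seq a))
    shape-below zero vanish = 0 , record
      { below-𝟙 = λ _ ()
      ; above-𝟘 = λ { zero () ; (suc i) _ → vanish i z≤n }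
      ; top≢𝟘   = 𝟙≢𝟘
      }
    shape-below (suc r) vanish with 𝟘? (seq a r)
    ... | inj₁ ar≡𝟘 = shape-below r (λ i r≤i → good-𝟘-up ar≡𝟘 (ℕP.≤⇒≤′ r≤i))
    ... | inj₂ ar≢𝟘 = suc r , record
      { below-𝟙 = λ { zero _ → refl
                    ; (suc i) (s≤s i<r) → good-𝟙-before (λ e → ar≢𝟘 (good-𝟘-up e (ℕP.≤⇒≤′ i<r))) }
      ; above-𝟘 = λ { zero () ; (suc i) (s≤s r<i) → vanish i r<i }
      ; top≢𝟘   = ar≢𝟘
      }

  len : GoodSeq → ℕ
  len a = proj₁ (shape-below a (proj₁ (fin a)) (proj₂ (fin a)))

  good-shape : ∀ a → Shape (seq a) (len a)
  good-shape a = proj₂ (shape-below a (proj₁ (fin a)) (proj₂ (fin a)))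

  term : Seq → Seq → ℕ → ℕ → Carrier
  term s₁ s₂ m j = ext s₁ (m ∸ j) ⊗ ext s₂ j

  ext-+ˢ : ∀ s₁ s₂ m → ext (s₁ +ˢ s₂) m ≡ sumTo (term s₁ s₂ m) m
  ext-+ˢ s₁ s₂ zero = sym (⊗-idem 𝟙)
  ext-+ˢ s₁ s₂ (suc m) = refl

  module Convolution {s₁ s₂ p q} (sh₁ : Shape s₁ p) (sh₂ : Shape s₂ q) where
    term-𝟘 : ∀ m j → (p <ℕ m ∸ j) ⊎ (q <ℕ j) → term s₁ s₂ m j ≡ 𝟘
    term-𝟘 m j (inj₁ p<m∸j) = trans (cong (_⊗ ext s₂ j) (above-𝟘 sh₁ (m ∸ j) p<m∸j)) (⊗-zeroˡ _)
    term-𝟘 m j (inj₂ q<j) = trans (cong (ext s₁ (m ∸ j) ⊗_) (above-𝟘 sh₂ j q<j)) (⊗-zeroʳ _)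

    term-nonzero : ∀ m j → m ∸ j ≤ℕ p → j ≤ℕ q → term s₁ s₂ m j ≢ 𝟘
    term-nonzero m j m∸j≤p j≤q =
      ⊗-nonzero (shape-nonzero sh₁ (m ∸ j) m∸j≤p) (shape-nonzero sh₂ j j≤q)

    -- Before position p + q: either one term is 𝟙 ⊗ 𝟙, or the terms j = m ∸ p
    -- and j = q are both nonzero.
    conv-below : ∀ m → m <ℕ p + q → sumTo (term s₁ s₂ m) m ≡ 𝟙
    conv-below m m<p+q with ℕP.<-≤-connex m q
    ... | inj₁ m<q = sumTo-𝟙 _ m m ℕP.≤-refl (begin
      ext s₁ (m ∸ m) ⊗ ext s₂ m  ≡⟨ cong₂ _⊗_ (cong (ext s₁) (ℕP.n∸n≡0 m)) (below-𝟙 sh₂ m m<q) ⟩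
      𝟙 ⊗ 𝟙                      ≡⟨ ⊗-idem 𝟙 ⟩
      𝟙                          ∎)
    ... | inj₂ q≤m with ℕP.<-≤-connex m p
    ...   | inj₁ m<p = sumTo-𝟙 _ 0 m z≤n (trans (⊗-identity _) (below-𝟙 sh₁ m m<p))
    ...   | inj₂ p≤m = sumTo-two _ (m ∸ p) q m m∸p<q q≤m
              (term-nonzero m (m ∸ p) (ℕP.≤-reflexive (ℕP.m∸[m∸n]≡n p≤m)) (ℕP.<⇒≤ m∸p<q))
              (term-nonzero m q m∸q≤p ℕP.≤-refl)
      where
        m∸p<q : m ∸ p <ℕ q
        m∸p<q = subst (m ∸ p <ℕ_) (ℕP.m+n∸m≡n p q) (ℕP.∸-monoˡ-< m<p+q p≤m)
        m∸q≤p : m ∸ q ≤ℕ p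
        m∸q≤p = ℕP.m≤n+o⇒m∸n≤o m q (subst (m ≤ℕ_) (ℕP.+-comm p q) (ℕP.<⇒≤ m<p+q))

    -- Past position p + q every term has a vanishing factor.
    conv-above : ∀ m → p + q <ℕ m → sumTo (term s₁ s₂ m) m ≡ 𝟘
    conv-above m p+q<m = sumTo-𝟘 _ m (λ j _ → term-𝟘 m j (vanishing j))
      where
        vanishing : ∀ j → (p <ℕ m ∸ j) ⊎ (q <ℕ j)
        vanishing j with ℕP.≤-<-connex j q
        ... | inj₁ j≤q = inj₁ (ℕP.m+n≤o⇒m≤o∸n (suc p)
                                 (ℕP.≤-trans (s≤s (ℕP.+-monoʳ-≤ p j≤q)) p+q<m))
        ... | inj₂ q<j = inj₂ q<j

    -- At position p + q only the term j = q survives.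
    conv-top : sumTo (term s₁ s₂ (p + q)) (p + q) ≡ (ext s₁ p ⊗ ext s₂ q)
    conv-top = trans (sumTo-single _ q (p + q) (ℕP.m≤n+m q p) others)
                     (cong (λ k → ext s₁ k ⊗ ext s₂ q) (ℕP.m+n∸n≡m p q))
      where
        others : ∀ j → j ≤ℕ p + q → j ≢ q → term s₁ s₂ (p + q) j ≡ 𝟘
        others j _ j≢q with ℕP.<-cmp j q
        ... | tri< j<q _ _ = term-𝟘 (p + q) j (inj₁ (ℕP.m+n≤o⇒m≤o∸n (suc p) (ℕP.+-monoʳ-< p j<q)))
        ... | tri≈ _ j≡q _ = ⊥-elim (j≢q j≡q)
        ... | tri> _ _ q<j = term-𝟘 (p + q) j (inj₂ q<j)

    +ˢ-top : ext (s₁ +ˢ s₂) (p + q) ≡ (ext s₁ p ⊗ ext s₂ q)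
    +ˢ-top = trans (ext-+ˢ s₁ s₂ (p + q)) conv-top

    +ˢ-shape : Shape (s₁ +ˢ s₂) (p + q)
    +ˢ-shape = record
      { below-𝟙 = λ m m<p+q → trans (ext-+ˢ s₁ s₂ m) (conv-below m m<p+q)
      ; above-𝟘 = λ m p+q<m → trans (ext-+ˢ s₁ s₂ m) (conv-above m p+q<m)
      ; top≢𝟘   = λ e → ⊗-nonzero (top≢𝟘 sh₁) (top≢𝟘 sh₂) (trans (sym +ˢ-top) e)
      }

  open Convolution using (+ˢ-shape; +ˢ-top)

  -- stair n κ = (𝟙, …, 𝟙, κ, 𝟘, 𝟘, …) with n leading 𝟙s; for κ ≠ 𝟘 it has length n + 1.
  stair : ℕ → Carrier → Seq
  stair zero    κ zero    = κ
  stair zero    κ (suc i) = 𝟘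
  stair (suc n) κ zero    = 𝟙
  stair (suc n) κ (suc i) = stair n κ i

  stair-shape : ∀ n {κ} → κ ≢ 𝟘 → Shape (stair n κ) (suc n)
  stair-shape n {κ} κ≢𝟘 = record
    { below-𝟙 = λ { zero _ → refl ; (suc i) (s≤s i<n) → ones n i i<n }
    ; above-𝟘 = λ { zero () ; (suc i) (s≤s n<i) → zeros n i n<i }
    ; top≢𝟘   = subst (_≢ 𝟘) (sym (top n)) κ≢𝟘
    }
    where
      ones : ∀ n i → i <ℕ n → stair n κ i ≡ 𝟙
      ones (suc n) zero    _         = refl
      ones (suc n) (suc i) (s≤s i<n) = ones n i i<n
      zeros : ∀ n i → n <ℕ i → stair n κ i ≡ 𝟘
      zeros zero    (suc i) _         = refl
      zeros (suc n) (suc i) (s≤s n<i) = zeros n i n<i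
      top : ∀ n → stair n κ n ≡ κ
      top zero    = refl
      top (suc n) = top n

  -- Equalising witness: for shaped s (top x) and s' (top y), adding the one-entry
  -- sequence (κ, 𝟘, …) with κ = x ⊗ y makes both top entries κ, by idempotence.
  module Equalise {s s' n n'} (sh : Shape s n) (sh' : Shape s' n') where
    κ : Carrier
    κ = ext s n ⊗ ext s' n'

    κ-shape : Shape (stair 0 κ) 1
    κ-shape = stair-shape 0 (⊗-nonzero (top≢𝟘 sh) (top≢𝟘 sh'))

    witness : GoodSeq
    witness = toGood κ-shape

    left-top : ext (s +ˢ stair 0 κ) (n + 1) ≡ κ
    left-top = trans (+ˢ-top sh κ-shape) (⊗-absorb (ext s n) (ext s' n'))

    right-top : ext (s' +ˢ stair 0 κ) (n' + 1) ≡ κ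
    right-top = begin
      ext (s' +ˢ stair 0 κ) (n' + 1)  ≡⟨ +ˢ-top sh' κ-shape ⟩
      y ⊗ (x ⊗ y)                     ≡⟨ cong (y ⊗_) (⊗-comm x y) ⟩
      y ⊗ (y ⊗ x)                     ≡⟨ ⊗-absorb y x ⟩
      y ⊗ x                           ≡⟨ ⊗-comm y x ⟩
      x ⊗ y                           ∎
      where
        x = ext s n
        y = ext s' n'

    padded-≗ : n ≡ n' → (s +ˢ stair 0 κ) ≗ˢ (s' +ˢ stair 0 κ)
    padded-≗ n≡n' = shape-≗ (+ˢ-shape sh κ-shape) (+ˢ-shape sh' κ-shape)
                            (cong (_+ 1) n≡n') (trans left-top (sym right-top))

    padded-≤ : n ≤ℕ n' → (s +ˢ stair 0 κ) ≤ˢ (s' +ˢ stair 0 κ)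
    padded-≤ n≤n' = shape-≤ˢ (+ˢ-shape sh κ-shape) (+ˢ-shape sh' κ-shape)
                             (ℕP.+-monoˡ-≤ 1 n≤n') (trans left-top (sym right-top))

  shape₂ : ∀ a d → Shape (seq a +ˢ seq d) (len a + len d)
  shape₂ a d = +ˢ-shape (good-shape a) (good-shape d)

  shape₃ : ∀ a d k → Shape ((seq a +ˢ seq d) +ˢ seq k) ((len a + len d) + len k)
  shape₃ a d k = +ˢ-shape (shape₂ a d) (good-shape k)

  len-sum : ∀ a b e → seq e ≗ˢ (seq a +ˢ seq b) → len e ≡ len a + len b
  len-sum a b e e≗a+b = shape-unique (good-shape e) (shape-cong (λ i → sym (e≗a+b i)) (shape₂ a b))

  closed : ∀ a b → Σ GoodSeq λ e → seq e ≗ˢ (seq a +ˢ seq b)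
  closed a b = toGood (shape₂ a b) , λ i → refl

  δ : Pair → ℤ
  δ (a , b) = + len a -ℤ + len b

  δ-respects : ∀ p q → p ∼ q → δ p ≡ δ q
  δ-respects (a , b) (c , d) (k , a+d+k≗b+c+k) =
    +≡⇒-≡ (+ len a) (+ len b) (+ len c) (+ len d) (cong +_ (ℕP.+-cancelʳ-≡ (len k) _ _
      (shape-unique (shape-cong a+d+k≗b+c+k (shape₃ a d k)) (shape₃ b c k))))

  δ-monotone : ∀ p q → p ⪯ q → δ p ≤ℤ δ q
  δ-monotone (a , b) (c , d) (k , a+d+k≤b+c+k) =
    +≤⇒-≤ (+ len a) (+ len b) (+ len c) (+ len d) (+≤+ (ℕP.+-cancelʳ-≤ (len k) _ _
      (shape-≤ (shape₃ a d k) (shape₃ b c k) a+d+k≤b+c+k)))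

  δ-reflects : ∀ p q → δ p ≡ δ q → p ∼ q
  δ-reflects (a , b) (c , d) δ≡ =
    Equalise.witness (shape₂ a d) (shape₂ b c) ,
    Equalise.padded-≗ (shape₂ a d) (shape₂ b c)
      (ℤP.+-injective (-≡⇒+≡ (+ len a) (+ len b) (+ len c) (+ len d) δ≡))

  δ-reflectsOrd : ∀ p q → δ p ≤ℤ δ q → p ⪯ q
  δ-reflectsOrd (a , b) (c , d) δ≤ =
    Equalise.witness (shape₂ a d) (shape₂ b c) ,
    Equalise.padded-≤ (shape₂ a d) (shape₂ b c)
      (ℤP.drop‿+≤+ (-≤⇒+≤ (+ len a) (+ len b) (+ len c) (+ len d) δ≤))

  δ-additive : ∀ p q r → IsPairSum p q r → δ r ≡ (δ p +ℤ δ q)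
  δ-additive (a , b) (c , d) (e , g) (e≗a+c , g≗b+d) = begin
    + len e -ℤ + len g                        ≡⟨ cong₂ (λ m n → + m -ℤ + n)
                                                   (len-sum a c e e≗a+c) (len-sum b d g g≗b+d) ⟩
    + (len a + len c) -ℤ + (len b + len d)    ≡⟨ regroup (+ len a) (+ len b) (+ len c) (+ len d) ⟩
    δ (a , b) +ℤ δ (c , d)                    ∎

  -- Staircases of 𝟙s realise every length, hence every integer.
  ones : ℕ → GoodSeq
  ones n = toGood (stair-shape n 𝟙≢𝟘)

  len-ones : ∀ n → len (ones n) ≡ suc n
  len-ones n = shape-unique (good-shape (ones n)) (stair-shape n 𝟙≢𝟘)

  δ-surjective : ∀ z → Σ Pair λ p → δ p ≡ z
  δ-surjective (+ n) =
    (ones n , ones 0) , cong₂ (λ m k → + m -ℤ + k) (len-ones n) (len-ones 0)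
  δ-surjective -[1+ n ] =
    (ones 0 , ones (suc n)) , cong₂ (λ m k → + m -ℤ + k) (len-ones 0) (len-ones (suc n))

proposition6p2 : (L : GodelAlgebra) → GodelAlgebra.TotallyOrdered L →
    GodelAlgebra.𝟘 L ≢ GodelAlgebra.𝟙 L → GodelAlgebra.ChangIsoℤ L
proposition6p2 L total 𝟘≢𝟙 = record
  { closed      = closed
  ; f           = δ
  ; respects    = δ-respects
  ; reflects    = δ-reflects
  ; surjective  = δ-surjective
  ; additive    = δ-additive
  ; monotone    = δ-monotone
  ; reflectsOrd = δ-reflectsOrd
  }
  where open TotalGodel L total 𝟘≢𝟙
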